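{- Let $G\in\mathcal{F}_3$ be a finite simple graph with $|V(G)|\geq 66$. Then $crx_3(G)>4$.
   Context: An edge-colouring of $G$ is an arbitrary (not necessarily proper) assignment of colours to the edges of $G$. An edge-coloured cycle is rainbow if all its edges have distinct colours. For $k\geq 1$, $\mathcal{F}_k$ denotes the family of all graphs in which any $k$ vertices lie on a common cycle. For $G\in\mathcal{F}_k$, a $k$-rainbow cycle colouring of $G$ is an edge-colouring such that any $k$ vertices of $G$ lie on a common rainbow cycle of $G$; the $k$-rainbow cycle index $crx_k(G)$ is the minimum number of colours in a $k$-rainbow cycle colouring of $G$ (defined exactly when $G\in\mathcal{F}_k$). -}

module Defs where

open import Data.Nat using (ℕ; _≤_; _>_)
open import Data.Fin using (Fin)
open import Data.List using (List; []; _∷_; _++_; [_]; zip; map; length)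
open import Data.List.Relation.Unary.All using (All)
open import Data.List.Relation.Unary.Unique.Propositional using (Unique)
open import Data.List.Membership.Propositional using (_∈_)
open import Data.Product using (Σ; _×_; _,_; uncurry)
open import Relation.Binary.PropositionalEquality using (_≡_; _≢_)
open import Relation.Nullary using (¬_)
open import Level using (0ℓ)

record SimpleGraph (n : ℕ) : Set₁ where
  field
    Adj   : Fin n → Fin n → Set
    sym   : ∀ {u v} → Adj u v → Adj v u
    irrefl : ∀ {u} → ¬ Adj u u
open SimpleGraph public

cyclePairs : ∀ {n} → List (Fin n) → List (Fin n × Fin n)
cyclePairs []       = []
cyclePairs (v ∷ vs) = zip (v ∷ vs) (vs ++ [ v ])

IsCycle : ∀ {n} → SimpleGraph n → List (Fin n) → Set
IsCycle G vs = (3 ≤ length vs) × Unique vs × All (uncurry (Adj G)) (cyclePairs vs)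

InF3 : ∀ {n} → SimpleGraph n → Set
InF3 {n} G = ∀ (x y z : Fin n) → x ≢ y → x ≢ z → y ≢ z →
  Σ (List (Fin n)) λ vs → IsCycle G vs × x ∈ vs × y ∈ vs × z ∈ vs

-- An edge-colouring with colours from C: a symmetric colour assignment to
-- (unordered) pairs of vertices; only its values on edges matter.
record EdgeColouring {n} (G : SimpleGraph n) (C : Set) : Set where
  field
    col    : Fin n → Fin n → C
    colSym : ∀ u v → col u v ≡ col v u
open EdgeColouring public

IsRainbow : ∀ {n} {G : SimpleGraph n} {C : Set} → EdgeColouring G C → List (Fin n) → Set
IsRainbow c vs = Unique (map (uncurry (col c)) (cyclePairs vs))

Is3RainbowCycleColouring : ∀ {n} {G : SimpleGraph n} {C : Set} → EdgeColouring G C → Set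
Is3RainbowCycleColouring {n} {G} c = ∀ (x y z : Fin n) → x ≢ y → x ≢ z → y ≢ z →
  Σ (List (Fin n)) λ vs → IsCycle G vs × IsRainbow c vs × x ∈ vs × y ∈ vs × z ∈ vs

-- crx₃(G) > k : no 3-rainbow cycle colouring uses at most k colours,
-- i.e. there is none with colour set Fin k.
crx3> : ∀ {n} → SimpleGraph n → ℕ → Set
crx3> G k = (c : EdgeColouring G (Fin k)) → ¬ Is3RainbowCycleColouring c

-- Suppose c is a 3-rainbow cycle colouring of G with colours Fin 4.  A rainbow
-- cycle has as many edges as vertices and all edge colours distinct, so it has
-- at most 4 vertices.  Among any three distinct vertices of a cycle of length 3
-- or 4, two of the three connecting pairs are cycle edges sharing a vertex (in a
-- 4-cycle the only non-edges are the two diagonals, and a vertex lies on just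
-- one of them); on a rainbow cycle these two edges get different colours.
-- Since any three vertices lie on a common rainbow cycle, the colouring
-- (u , v) ↦ col c u v of the complete graph on Fin n has no monochromatic
-- triangle.  The classical neighbourhood argument bounds the number of vertices
-- of a complete graph whose k-colouring has no monochromatic triangle by
-- f(k) = 1 + k·f(k−1), f(0) = 1, and f(4) = 65 < 66 ≤ n.
module Submission where

open import Defs hiding (sym)
open import Data.Nat using (ℕ; zero; suc; _+_; _*_; _≤_; z≤n; s≤s; s≤s⁻¹)
open import Data.Nat.Properties
  using (≤-trans; ≤-refl; ≤-reflexive; +-mono-≤; +-suc; *-monoˡ-≤; *-identityʳ; ≤⇒≯; module ≤-Reasoning)
open import Data.Fin using (Fin; _≟_)
open import Data.List using (List; []; _∷_; _++_; [_]; zip; map; length; filter; allFin)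
open import Data.List.Properties using (length-map; length-tabulate; filter-notAll)
open import Data.List.Relation.Unary.All as All using ([]; _∷_)
open import Data.List.Relation.Unary.Any as Any using (here; there)
open import Data.List.Relation.Unary.AllPairs using ([]; _∷_)
open import Data.List.Relation.Unary.Unique.Propositional using (Unique)
import Data.List.Relation.Unary.Unique.Propositional.Properties as Unique
import Data.List.Relation.Binary.Sublist.Propositional.Properties as Sublist
open import Data.List.Membership.Propositional using (_∈_)
open import Data.List.Membership.Propositional.Properties using (∈-filter⁻; ∈-filter⁺; ∈-map⁺; ∈-allFin)
open import Data.Product using (_,_; proj₂; uncurry)
open import Data.Sum using (_⊎_; inj₁; inj₂; swap)
open import Data.Empty using (⊥-elim)
open import Function using (id)
open import Relation.Nullary using (yes; no; ¬?)
open import Relation.Unary using (Decidable)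
open import Relation.Binary.Definitions using (DecidableEquality)
open import Relation.Binary.PropositionalEquality using (_≡_; _≢_; refl; sym; trans; cong; module ≡-Reasoning)

length-filter-split : ∀ {A : Set} {P : A → Set} (P? : Decidable P) (xs : List A) →
  length xs ≡ length (filter P? xs) + length (filter (λ x → ¬? (P? x)) xs)
length-filter-split P? []       = refl
length-filter-split P? (x ∷ xs) with P? x
... | yes _ = cong suc (length-filter-split P? xs)
... | no  _ = trans (cong suc (length-filter-split P? xs)) (sym (+-suc _ _))

constant-unique-length≤1 : ∀ {A : Set} {c : A} {M : List A} → Unique M →
  (∀ {x} → x ∈ M → x ≡ c) → length M ≤ 1
constant-unique-length≤1 {M = []}         _                 _     = z≤n
constant-unique-length≤1 {M = _ ∷ []}     _                 _     = ≤-refl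
constant-unique-length≤1 {M = _ ∷ _ ∷ _} ((x≢y ∷ _) ∷ _) all≡c =
  ⊥-elim (x≢y (trans (all≡c (here refl)) (sym (all≡c (there (here refl))))))

unique-map-injective : ∀ {A B : Set} (g : A → B) {L : List A} → Unique (map g L) →
  ∀ {x y} → x ∈ L → y ∈ L → g x ≡ g y → x ≡ y
unique-map-injective g _              (here refl) (here refl) _ = refl
unique-map-injective g (gx∉ ∷ _)     (here refl) (there y∈)  e = ⊥-elim (All.lookup gx∉ (∈-map⁺ g y∈) e)
unique-map-injective g (gy∉ ∷ _)     (there x∈)  (here refl) e = ⊥-elim (All.lookup gy∉ (∈-map⁺ g x∈) (sym e))
unique-map-injective g (_ ∷ unique)  (there x∈)  (there y∈)  e = unique-map-injective g unique x∈ y∈ e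

module _ {A C : Set} (_≟ᶜ_ : DecidableEquality C) (g : A → C) where

  colourClass : C → List A → List A
  colourClass c = filter (λ x → g x ≟ᶜ c)

  pigeonhole : (B : ℕ) (cs : List C) (L : List A) → (∀ {x} → x ∈ L → g x ∈ cs) →
               (∀ {c} → c ∈ cs → length (colourClass c L) ≤ B) → length L ≤ length cs * B
  pigeonhole B [] []      _        _     = z≤n
  pigeonhole B [] (_ ∷ _) colour∈  _     with colour∈ (here refl)
  ... | ()
  pigeonhole B (c ∷ cs) L colour∈ bound = begin
      length L                                    ≡⟨ length-filter-split (λ x → g x ≟ᶜ c) L ⟩
      length (colourClass c L) + length others    ≤⟨ +-mono-≤ (bound (here refl))
                                                       (pigeonhole B cs others others∈ othersBound) ⟩
      B + length cs * B                           ∎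
    where
      open ≤-Reasoning
      others : List A
      others = filter (λ x → ¬? (g x ≟ᶜ c)) L

      others∈ : ∀ {x} → x ∈ others → g x ∈ cs
      others∈ x∈ with ∈-filter⁻ _ x∈
      ... | x∈L , gx≢c with colour∈ x∈L
      ...   | here gx≡c = ⊥-elim (gx≢c gx≡c)
      ...   | there gx∈ = gx∈

      othersBound : ∀ {d} → d ∈ cs → length (colourClass d others) ≤ B
      othersBound {d} d∈ = ≤-trans
        (Sublist.length-mono-≤ (Sublist.filter⁺ (λ x → g x ≟ᶜ d) (λ x → g x ≟ᶜ d) (λ { refl p → p })
                                                 (Sublist.filter-⊆ _ L)))
        (bound (there d∈))

unique-length≤ : ∀ {k} (L : List (Fin k)) → Unique L → length L ≤ k
unique-length≤ {k} L unique = begin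
    length L               ≤⟨ pigeonhole _≟_ id 1 (allFin k) L (λ {x} _ → ∈-allFin x) classBound ⟩
    length (allFin k) * 1  ≡⟨ *-identityʳ _ ⟩
    length (allFin k)      ≡⟨ length-tabulate id ⟩
    k                      ∎
  where
    open ≤-Reasoning
    classBound : ∀ {c} → c ∈ allFin k → length (colourClass _≟_ id c L) ≤ 1
    classBound {c} _ = constant-unique-length≤1 (Unique.filter⁺ (_≟ c) unique)
                                                (λ x∈ → proj₂ (∈-filter⁻ (_≟ c) {xs = L} x∈))

TriangleFree : {V C : Set} → (V → V → C) → Set
TriangleFree κ = ∀ {a b d} → a ≢ b → a ≢ d → b ≢ d → κ a b ≡ κ a d → κ b d ≢ κ a b

-- f(k) = 1 + k·f(k−1): more vertices force a monochromatic triangle; f(4) = 65.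
ramseyBound : ℕ → ℕ
ramseyBound zero    = 1
ramseyBound (suc k) = suc (suc k * ramseyBound k)

module _ {V C : Set} (_≟ᶜ_ : DecidableEquality C) (κ : V → V → C) (triangleFree : TriangleFree κ) where

  UsesPalette : List V → List C → Set
  UsesPalette L cs = ∀ {x y} → x ∈ L → y ∈ L → x ≢ y → κ x y ∈ cs

  -- Neighbourhood argument: the neighbours of a vertex a of colour c see no
  -- pair of colour c among themselves, so they use a palette without c.
  ramsey : (k : ℕ) (cs : List C) → length cs ≤ k → (L : List V) → Unique L →
           UsesPalette L cs → length L ≤ ramseyBound k
  ramsey k        cs       _   []          _ _ = z≤n
  ramsey zero     (_ ∷ _)  ()  _           _ _
  ramsey zero     []       _   (_ ∷ [])    _ _ = ≤-refl
  ramsey zero     []       _   (_ ∷ _ ∷ _) ((a≢b ∷ _) ∷ _) palette with palette (here refl) (there (here refl)) a≢b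
  ... | ()
  ramsey (suc k)  cs       |cs|≤ (a ∷ rest) (a∉rest ∷ unique) palette = s≤s (begin
      length rest               ≤⟨ pigeonhole _≟ᶜ_ (κ a) (ramseyBound k) cs rest colour∈ classBound ⟩
      length cs * ramseyBound k ≤⟨ *-monoˡ-≤ (ramseyBound k) |cs|≤ ⟩
      suc k * ramseyBound k     ∎)
    where
      open ≤-Reasoning
      a≢ : ∀ {x} → x ∈ rest → a ≢ x
      a≢ = All.lookup a∉rest

      colour∈ : ∀ {x} → x ∈ rest → κ a x ∈ cs
      colour∈ x∈ = palette (here refl) (there x∈) (a≢ x∈)

      classBound : ∀ {c} → c ∈ cs → length (colourClass _≟ᶜ_ (κ a) c rest) ≤ ramseyBound k
      classBound {c} c∈ = ramsey k smaller smaller≤k (colourClass _≟ᶜ_ (κ a) c rest)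
                                  (Unique.filter⁺ _ unique) classPalette
        where
          smaller : List C
          smaller = filter (λ d → ¬? (d ≟ᶜ c)) cs

          smaller≤k : length smaller ≤ k
          smaller≤k = s≤s⁻¹ (≤-trans (filter-notAll _ cs (Any.map (λ c≡d d≢c → d≢c (sym c≡d)) c∈)) |cs|≤)

          classPalette : UsesPalette (colourClass _≟ᶜ_ (κ a) c rest) smaller
          classPalette x∈ y∈ x≢y with ∈-filter⁻ _ x∈ | ∈-filter⁻ _ y∈
          ... | x∈rest , ax≡c | y∈rest , ay≡c =
            ∈-filter⁺ _ (palette (there x∈rest) (there y∈rest) x≢y)
              (λ xy≡c → triangleFree (a≢ x∈rest) (a≢ y∈rest) x≢y (trans ax≡c (sym ay≡c)) (trans xy≡c (sym ax≡c)))

triangleFree-vertices≤ : ∀ {n k} (κ : Fin n → Fin n → Fin k) → TriangleFree κ → n ≤ ramseyBound k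
triangleFree-vertices≤ {n} {k} κ triangleFree = begin
    n                   ≡⟨ sym (length-tabulate id) ⟩
    length (allFin n)   ≤⟨ ramsey _≟_ κ triangleFree k (allFin k) (≤-reflexive (length-tabulate id))
                                  (allFin n) (Unique.allFin⁺ n) (λ {x} {y} _ _ _ → ∈-allFin (κ x y)) ⟩
    ramseyBound k       ∎
  where open ≤-Reasoning

length-cyclePairs : ∀ {n} (vs : List (Fin n)) → length (cyclePairs vs) ≡ length vs
length-cyclePairs []       = refl
length-cyclePairs {n} (v ∷ vs) = length-shifted-zip v vs
  where
    length-shifted-zip : ∀ (x : Fin n) (xs : List (Fin n)) → length (zip (x ∷ xs) (xs ++ [ v ])) ≡ suc (length xs)
    length-shifted-zip x []       = refl
    length-shifted-zip x (y ∷ ys) = cong suc (length-shifted-zip y ys)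

rainbow-length≤ : ∀ {n k} {G : SimpleGraph n} (c : EdgeColouring G (Fin k)) (vs : List (Fin n)) →
  IsRainbow c vs → length vs ≤ k
rainbow-length≤ c vs rainbow = begin
    length vs                                        ≡⟨ sym (length-cyclePairs vs) ⟩
    length (cyclePairs vs)                           ≡⟨ sym (length-map _ (cyclePairs vs)) ⟩
    length (map (uncurry (col c)) (cyclePairs vs))   ≤⟨ unique-length≤ _ rainbow ⟩
    _                                                ∎
  where open ≤-Reasoning

CycleEdge : ∀ {n} → List (Fin n) → Fin n → Fin n → Set
CycleEdge vs x y = (x , y) ∈ cyclePairs vs ⊎ (y , x) ∈ cyclePairs vs

rainbow-injective : ∀ {n C} {G : SimpleGraph n} (c : EdgeColouring G C) {vs : List (Fin n)} → IsRainbow c vs →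
  ∀ {e f} → e ∈ cyclePairs vs → f ∈ cyclePairs vs → uncurry (col c) e ≡ uncurry (col c) f → e ≡ f
rainbow-injective c = unique-map-injective (uncurry (col c))

rainbow-adjacent : ∀ {n C} {G : SimpleGraph n} (c : EdgeColouring G C) {vs : List (Fin n)} → IsRainbow c vs →
  ∀ {u v w} → CycleEdge vs u v → CycleEdge vs u w → v ≢ w → col c u v ≢ col c u w
rainbow-adjacent c {vs} rainbow (inj₁ uv) (inj₁ uw) v≢w e
  with refl ← rainbow-injective c {vs} rainbow uv uw e = v≢w refl
rainbow-adjacent c {vs} rainbow {u} {v} {w} (inj₁ uv) (inj₂ wu) v≢w e
  with refl ← rainbow-injective c {vs} rainbow uv wu (trans e (colSym c u w)) = v≢w refl
rainbow-adjacent c {vs} rainbow {u} {v} {w} (inj₂ vu) (inj₁ uw) v≢w e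
  with refl ← rainbow-injective c {vs} rainbow vu uw (trans (sym (colSym c u v)) e) = v≢w refl
rainbow-adjacent c {vs} rainbow {u} {v} {w} (inj₂ vu) (inj₂ wu) v≢w e
  with refl ← rainbow-injective c {vs} rainbow vu wu (trans (sym (colSym c u v)) (trans e (colSym c u w))) = v≢w refl

pattern at₀ = here refl
pattern at₁ = there (here refl)
pattern at₂ = there (there (here refl))
pattern at₃ = there (there (there (here refl)))

triangle-edge : ∀ {n} {p q r x y : Fin n} → x ∈ p ∷ q ∷ r ∷ [] → y ∈ p ∷ q ∷ r ∷ [] → x ≢ y →
  CycleEdge (p ∷ q ∷ r ∷ []) x y
triangle-edge at₀ at₀ x≢y = ⊥-elim (x≢y refl)
triangle-edge at₀ at₁ _   = inj₁ at₀
triangle-edge at₀ at₂ _   = inj₂ at₂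
triangle-edge at₁ at₀ _   = inj₂ at₀
triangle-edge at₁ at₁ x≢y = ⊥-elim (x≢y refl)
triangle-edge at₁ at₂ _   = inj₁ at₁
triangle-edge at₂ at₀ _   = inj₁ at₂
triangle-edge at₂ at₁ _   = inj₂ at₁
triangle-edge at₂ at₂ x≢y = ⊥-elim (x≢y refl)

data Diagonal {n} (p q r s : Fin n) : Fin n → Fin n → Set where
  pr : Diagonal p q r s p r
  rp : Diagonal p q r s r p
  qs : Diagonal p q r s q s
  sq : Diagonal p q r s s q

diagonal-sym : ∀ {n} {p q r s x y : Fin n} → Diagonal p q r s x y → Diagonal p q r s y x
diagonal-sym pr = rp
diagonal-sym rp = pr
diagonal-sym qs = sq
diagonal-sym sq = qs

diagonal-unique : ∀ {n} {p q r s x y z : Fin n} → Unique (p ∷ q ∷ r ∷ s ∷ []) →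
  Diagonal p q r s x y → Diagonal p q r s x z → y ≡ z
diagonal-unique _                                   pr pr = refl
diagonal-unique _                                   rp rp = refl
diagonal-unique _                                   qs qs = refl
diagonal-unique _                                   sq sq = refl
diagonal-unique ((_ ∷ p≢r ∷ _) ∷ _)               pr rp = ⊥-elim (p≢r refl)
diagonal-unique ((p≢q ∷ _) ∷ _)                    pr qs = ⊥-elim (p≢q refl)
diagonal-unique ((_ ∷ _ ∷ p≢s ∷ _) ∷ _)           pr sq = ⊥-elim (p≢s refl)
diagonal-unique ((_ ∷ p≢r ∷ _) ∷ _)               rp pr = ⊥-elim (p≢r refl)
diagonal-unique (_ ∷ (q≢r ∷ _) ∷ _)                rp qs = ⊥-elim (q≢r refl)
diagonal-unique (_ ∷ _ ∷ (r≢s ∷ _) ∷ _)            rp sq = ⊥-elim (r≢s refl)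
diagonal-unique ((p≢q ∷ _) ∷ _)                    qs pr = ⊥-elim (p≢q refl)
diagonal-unique (_ ∷ (q≢r ∷ _) ∷ _)                qs rp = ⊥-elim (q≢r refl)
diagonal-unique (_ ∷ (_ ∷ q≢s ∷ _) ∷ _)            qs sq = ⊥-elim (q≢s refl)
diagonal-unique ((_ ∷ _ ∷ p≢s ∷ _) ∷ _)           sq pr = ⊥-elim (p≢s refl)
diagonal-unique (_ ∷ _ ∷ (r≢s ∷ _) ∷ _)            sq rp = ⊥-elim (r≢s refl)
diagonal-unique (_ ∷ (_ ∷ q≢s ∷ _) ∷ _)            sq qs = ⊥-elim (q≢s refl)

square-edge : ∀ {n} {p q r s x y : Fin n} → x ∈ p ∷ q ∷ r ∷ s ∷ [] → y ∈ p ∷ q ∷ r ∷ s ∷ [] → x ≢ y →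
  CycleEdge (p ∷ q ∷ r ∷ s ∷ []) x y ⊎ Diagonal p q r s x y
square-edge at₀ at₀ x≢y = ⊥-elim (x≢y refl)
square-edge at₀ at₁ _   = inj₁ (inj₁ at₀)
square-edge at₀ at₂ _   = inj₂ pr
square-edge at₀ at₃ _   = inj₁ (inj₂ at₃)
square-edge at₁ at₀ _   = inj₁ (inj₂ at₀)
square-edge at₁ at₁ x≢y = ⊥-elim (x≢y refl)
square-edge at₁ at₂ _   = inj₁ (inj₁ at₁)
square-edge at₁ at₃ _   = inj₂ qs
square-edge at₂ at₀ _   = inj₂ rp
square-edge at₂ at₁ _   = inj₁ (inj₂ at₁)
square-edge at₂ at₂ x≢y = ⊥-elim (x≢y refl)
square-edge at₂ at₃ _   = inj₁ (inj₁ at₂)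
square-edge at₃ at₀ _   = inj₁ (inj₁ at₃)
square-edge at₃ at₁ _   = inj₂ sq
square-edge at₃ at₂ _   = inj₁ (inj₂ at₂)
square-edge at₃ at₃ x≢y = ⊥-elim (x≢y refl)

data TwoSidesAtApex {V : Set} (E : V → V → Set) (a b d : V) : Set where
  apex-a : E a b → E a d → TwoSidesAtApex E a b d
  apex-b : E b a → E b d → TwoSidesAtApex E a b d
  apex-d : E d a → E d b → TwoSidesAtApex E a b d

-- In a 4-cycle at most one side of a triangle of vertices is a diagonal
-- (CycleEdge is symmetric via swap).
square-two-sides : ∀ {n} {p q r s a b d : Fin n} → Unique (p ∷ q ∷ r ∷ s ∷ []) →
  a ∈ p ∷ q ∷ r ∷ s ∷ [] → b ∈ p ∷ q ∷ r ∷ s ∷ [] → d ∈ p ∷ q ∷ r ∷ s ∷ [] →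
  a ≢ b → a ≢ d → b ≢ d → TwoSidesAtApex (CycleEdge (p ∷ q ∷ r ∷ s ∷ [])) a b d
square-two-sides distinct a∈ b∈ d∈ a≢b a≢d b≢d
  with square-edge a∈ b∈ a≢b | square-edge a∈ d∈ a≢d | square-edge b∈ d∈ b≢d
... | inj₁ ab | inj₁ ad | _       = apex-a ab ad
... | inj₁ ab | inj₂ _  | inj₁ bd = apex-b (swap ab) bd
... | inj₂ _  | inj₁ ad | inj₁ bd = apex-d (swap ad) (swap bd)
... | inj₂ ab | inj₂ ad | _       = ⊥-elim (b≢d (diagonal-unique distinct ab ad))
... | _       | inj₂ ad | inj₂ bd = ⊥-elim (a≢b (diagonal-unique distinct (diagonal-sym ad) (diagonal-sym bd)))
... | inj₂ ab | _       | inj₂ bd = ⊥-elim (a≢d (diagonal-unique distinct (diagonal-sym ab) bd))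

short-cycle-two-sides : ∀ {n} (vs : List (Fin n)) → 3 ≤ length vs → length vs ≤ 4 → Unique vs →
  ∀ {a b d} → a ∈ vs → b ∈ vs → d ∈ vs → a ≢ b → a ≢ d → b ≢ d → TwoSidesAtApex (CycleEdge vs) a b d
short-cycle-two-sides (_ ∷ _ ∷ _ ∷ [])          _ _ _        a∈ b∈ d∈ a≢b a≢d _ =
  apex-a (triangle-edge a∈ b∈ a≢b) (triangle-edge a∈ d∈ a≢d)
short-cycle-two-sides (_ ∷ _ ∷ _ ∷ _ ∷ [])      _ _ distinct a∈ b∈ d∈ a≢b a≢d b≢d =
  square-two-sides distinct a∈ b∈ d∈ a≢b a≢d b≢d
short-cycle-two-sides []                        () _
short-cycle-two-sides (_ ∷ [])                  (s≤s ()) _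
short-cycle-two-sides (_ ∷ _ ∷ [])              (s≤s (s≤s ())) _
short-cycle-two-sides (_ ∷ _ ∷ _ ∷ _ ∷ _ ∷ _)   _ (s≤s (s≤s (s≤s (s≤s ()))))

rainbowCycleColouring⇒triangleFree : ∀ {n k} {G : SimpleGraph n} (c : EdgeColouring G (Fin k)) → k ≤ 4 →
  Is3RainbowCycleColouring c → TriangleFree (col c)
rainbowCycleColouring⇒triangleFree c k≤4 rainbowColouring {a} {b} {d} a≢b a≢d b≢d ab≡ad bd≡ab
  with rainbowColouring a b d a≢b a≢d b≢d
... | vs , (length≥3 , distinct , _) , rainbow , a∈ , b∈ , d∈
  with short-cycle-two-sides vs length≥3 (≤-trans (rainbow-length≤ c vs rainbow) k≤4) distinct a∈ b∈ d∈ a≢b a≢d b≢d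
... | apex-a ab ad = rainbow-adjacent c {vs} rainbow ab ad b≢d ab≡ad
... | apex-b ba bd = rainbow-adjacent c {vs} rainbow ba bd a≢d (trans (sym (colSym c a b)) (sym bd≡ab))
... | apex-d da db = rainbow-adjacent c {vs} rainbow da db a≢b (begin
    col c d a  ≡⟨ sym (colSym c a d) ⟩
    col c a d  ≡⟨ sym ab≡ad ⟩
    col c a b  ≡⟨ sym bd≡ab ⟩
    col c b d  ≡⟨ colSym c b d ⟩
    col c d b  ∎)
  where open ≡-Reasoning

theorem7 : (n : ℕ) → 66 ≤ n → (G : SimpleGraph n) → InF3 G → crx3> G 4
theorem7 n 66≤n G _ c rainbowColouring = ≤⇒≯ n≤65 66≤n
  where
    n≤65 : n ≤ ramseyBound 4
    n≤65 = triangleFree-vertices≤ (col c) (rainbowCycleColouring⇒triangleFree c ≤-refl rainbowColouring)
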